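{- Let $(V,d)$ be a finite metric space with $n$ points partitioned into $m$ colors $V = V_1 \cup \cdots \cup V_m$, and let integers $k$ and $\ell_i \le u_i$ ($i \in [m]$) be given. Let $\tau > 0$ and suppose there is a set $O \subseteq V$ satisfying the fairness constraints with $\mathrm{div}(O) \geq \tau$. Let $U$ be any output of $\mathrm{PRUNE}(V, d, \tau/3, n)$. Then there is a set $S \subseteq U$ satisfying the fairness constraints with $\mathrm{div}(S) \geq \tau/3$.
   Context: A set $S \subseteq V$ satisfies the fairness constraints if $|S| = k$ and $\ell_i \leq |S \cap V_i| \leq u_i$ for every $i \in [m]$. The diversity score is $\mathrm{div}(S) = \min_{u,v \in S,\, u \neq v} d(u,v)$. The procedure $\mathrm{PRUNE}(V,d,\gamma,b)$ works as follows. For each color $i \in [m]$: label all points of $V_i$ as unmarked and set $U_i = \emptyset$; while there is an unmarked point in $V_i$ and $|U_i| \leq b$, pick any unmarked $v \in V_i$, mark all points of $\{u \in V_i : d(u,v) < \gamma\}$, and add $v$ to $U_i$. The output is $U = U_1 \cup \cdots \cup U_m$ (the choice of unmarked point is arbitrary).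
   Formalization: The distances of the metric d and the threshold τ take values in the rationals. -}

module Defs where

open import Data.Nat using (ℕ; _≤_; _<_)
open import Data.Fin using (Fin; _≟_)
open import Data.Fin.Subset using (Subset; _∈_; _∉_; _⊆_; _∩_; _∪_; ⁅_⁆; ⋃; ∣_∣; ⊥)
open import Data.Vec using (tabulate)
open import Data.List as List using ()
open import Data.Bool using (_∧_)
open import Data.Product using (_×_; Σ)
open import Data.Sum using (_⊎_)
open import Relation.Nullary using (¬_; does)
open import Relation.Binary.PropositionalEquality using (_≡_)
open import Data.Rational as ℚ using (ℚ; 0ℚ)
open import Data.Rational.Properties using (_<?_)

record IsMetric {n : ℕ} (d : Fin n → Fin n → ℚ) : Set where
  field
    zero-self : ∀ u → d u u ≡ 0ℚ
    pos       : ∀ u v → ¬ (u ≡ v) → 0ℚ ℚ.< d u v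
    sym       : ∀ u v → d u v ≡ d v u
    triangle  : ∀ u v w → d u w ℚ.≤ d u v ℚ.+ d v w

module _ {n m : ℕ} (col : Fin n → Fin m) (d : Fin n → Fin n → ℚ) where

  Class : Fin m → Subset n
  Class i = tabulate (λ v → does (col v ≟ i))

  Fair : (k : ℕ) (ℓ u : Fin m → ℕ) → Subset n → Set
  Fair k ℓ u S = (∣ S ∣ ≡ k) × (∀ i → (ℓ i ≤ ∣ S ∩ Class i ∣) × (∣ S ∩ Class i ∣ ≤ u i))

  -- div(S) ≥ t  (min over distinct pairs; vacuous if |S| ≤ 1)
  DivAtLeast : Subset n → ℚ → Set
  DivAtLeast S t = ∀ x y → x ∈ S → y ∈ S → ¬ (x ≡ y) → t ℚ.≤ d x y

  Ball : Fin m → ℚ → Fin n → Subset n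
  Ball i γ v = tabulate (λ w → does (col w ≟ i) ∧ does (d w v <? γ))

  -- PruneRun i γ b M Uᵢ F : starting from marked set M and current Uᵢ, the
  -- while-loop of PRUNE for colour i can terminate with final set F
  -- (arbitrary choice of the unmarked point at each step).
  data PruneRun (i : Fin m) (γ : ℚ) (b : ℕ) : Subset n → Subset n → Subset n → Set where
    stop : ∀ {M U} → (∀ v → v ∈ Class i → v ∈ M) ⊎ (b < ∣ U ∣) → PruneRun i γ b M U U
    step : ∀ {M U F} v → v ∈ Class i → v ∉ M → ∣ U ∣ ≤ b →
           PruneRun i γ b (M ∪ Ball i γ v) (U ∪ ⁅ v ⁆) F → PruneRun i γ b M U F

  PruneOutput : ℚ → ℕ → Subset n → Set
  PruneOutput γ b U =
    Σ (Fin m → Subset n) λ Us → (∀ i → PruneRun i γ b ⊥ ⊥ (Us i)) × (U ≡ ⋃ (List.tabulate Us))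

{-# OPTIONS --safe #-}
module Submission where

open import Defs
open import Data.Nat using (ℕ; _≤_)
open import Data.Fin using (Fin)
open import Data.Fin.Subset using (Subset; _⊆_)
open import Data.Product using (Σ; _×_)
open import Data.Rational using (ℚ; 0ℚ; _<_; _÷_; _/_)
open import Data.Integer using (+_)

open import Data.Empty using (⊥-elim)
open import Data.Fin using (_≟_)
open import Data.Fin.Properties using (any?; suc-injective; 0≢1+n)
open import Data.Fin.Subset using (_∈_; _∩_; _∪_; _-_; ⁅_⁆; ⋃; ∣_∣; inside; outside)
open import Data.Fin.Subset.Properties
open import Data.List using (List)
open import Data.List.Relation.Unary.Any using (Any; here; there)
import Data.List.Relation.Unary.Any.Properties as Any
import Data.Nat as ℕ
import Data.Nat.Properties as ℕ
open import Data.Product using (_,_; proj₁; proj₂; ∃-syntax)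
open import Data.Rational as ℚ using (1/_)
open import Data.Rational.Properties as ℚ using (_<?_)
open import Data.Sum using (inj₁; inj₂; [_,_])
open import Data.Vec as Vec using (tabulate; []; _∷_)
open import Data.Vec.Properties using (lookup∘tabulate; []=⇒lookup; lookup⇒[]=)
open import Function using (_∘_; _⇔_; mk⇔; Equivalence)
open import Relation.Nullary using (yes; no; does; _×-dec_)
open import Relation.Nullary.Decidable using (dec-true; decidable-stable)
open import Relation.Unary using (Pred; Decidable)
open import Relation.Binary.PropositionalEquality using (_≡_; _≢_; refl; sym; trans; cong; subst; module ≡-Reasoning)

-- PRUNE with budget b ≥ n never stops early, so it ends only once every point
-- of V_i is within γ = τ/3 of a chosen centre of the same colour.  Sending each
-- point of O to such a centre gives S: two distinct points of O are ≥ 3γ apart,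
-- so by the triangle inequality their centres are ≥ γ apart; in particular the
-- map is injective on O, and since it preserves colours, S has exactly the
-- colour counts of O.

module _ {n} {p} {P : Pred (Fin n) p} (P? : Decidable P) where

  ∈-tabulate⁻ : ∀ {x} → x ∈ tabulate (does ∘ P?) → P x
  ∈-tabulate⁻ {x} x∈ with P? x | trans (sym (lookup∘tabulate (does ∘ P?) x)) ([]=⇒lookup x∈)
  ... | yes Px | _ = Px
  ... | no _   | ()

  ∈-tabulate⁺ : ∀ {x} → P x → x ∈ tabulate (does ∘ P?)
  ∈-tabulate⁺ {x} Px = lookup⇒[]= x _ (trans (lookup∘tabulate (does ∘ P?) x) (dec-true (P? x) Px))

x∈⋃⁺ : ∀ {n} {x : Fin n} {ps : List (Subset n)} → Any (x ∈_) ps → x ∈ ⋃ ps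
x∈⋃⁺ (here x∈p)    = x∈p∪q⁺ (inj₁ x∈p)
x∈⋃⁺ (there x∈ps) = x∈p∪q⁺ (inj₂ (x∈⋃⁺ x∈ps))

-- The map may use the membership proof, so a chosen preimage also counts as an injection.
injection⇒∣p∣≤∣q∣ : ∀ {n n′} {p : Subset n} {q : Subset n′} (f : ∀ {x} → x ∈ p → Fin n′) →
  (∀ {x} (x∈p : x ∈ p) → f x∈p ∈ q) →
  (∀ {x y} (x∈p : x ∈ p) (y∈p : y ∈ p) → f x∈p ≡ f y∈p → x ≡ y) →
  ∣ p ∣ ≤ ∣ q ∣
injection⇒∣p∣≤∣q∣ {p = []} f f∈q f-inj = ℕ.z≤n
injection⇒∣p∣≤∣q∣ {p = outside ∷ p} f f∈q f-inj =
  injection⇒∣p∣≤∣q∣ (f ∘ Vec.there) (f∈q ∘ Vec.there)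
    (λ x∈p y∈p → suc-injective ∘ f-inj (Vec.there x∈p) (Vec.there y∈p))
injection⇒∣p∣≤∣q∣ {p = inside ∷ p} {q} f f∈q f-inj =
  ℕ.≤-trans (ℕ.s≤s ∣p∣≤∣q-f₀∣) (x∈p⇒∣p-x∣<∣p∣ (f∈q Vec.here))
  where
  ∣p∣≤∣q-f₀∣ : ∣ p ∣ ≤ ∣ q - f Vec.here ∣
  ∣p∣≤∣q-f₀∣ = injection⇒∣p∣≤∣q∣ (f ∘ Vec.there)
    (λ x∈p → x∈p∧x≢y⇒x∈p-y (f∈q (Vec.there x∈p)) (0≢1+n ∘ sym ∘ f-inj (Vec.there x∈p) Vec.here))
    (λ x∈p y∈p → suc-injective ∘ f-inj (Vec.there x∈p) (Vec.there y∈p))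

module _ {n n′} (f : Fin n → Fin n′) where

  InjectiveOn : Subset n → Set
  InjectiveOn p = ∀ {x y} → x ∈ p → y ∈ p → f x ≡ f y → x ≡ y

  image : Subset n → Subset n′
  image p = tabulate (does ∘ λ y → any? λ x → (x ∈? p) ×-dec (f x ≟ y))

  ∈-image⁻ : ∀ {p y} → y ∈ image p → ∃[ x ] x ∈ p × f x ≡ y
  ∈-image⁻ {p} = ∈-tabulate⁻ (λ y → any? λ x → (x ∈? p) ×-dec (f x ≟ y))

  ∈-image⁺ : ∀ {p x} → x ∈ p → f x ∈ image p
  ∈-image⁺ {p} {x} x∈p = ∈-tabulate⁺ (λ y → any? λ x → (x ∈? p) ×-dec (f x ≟ y)) (x , x∈p , refl)

  ∣image∣≡∣p∣ : ∀ {p} → InjectiveOn p → ∣ image p ∣ ≡ ∣ p ∣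
  ∣image∣≡∣p∣ {p} f-inj = ℕ.≤-antisym
    (injection⇒∣p∣≤∣q∣ (proj₁ ∘ ∈-image⁻) (proj₁ ∘ proj₂ ∘ ∈-image⁻)
      λ y∈ y′∈ eq → trans (sym (proj₂ (proj₂ (∈-image⁻ y∈)))) (trans (cong f eq) (proj₂ (proj₂ (∈-image⁻ y′∈)))))
    (injection⇒∣p∣≤∣q∣ (λ {x} _ → f x) ∈-image⁺ f-inj)

  injectiveOn-⊆ : ∀ {p q} → p ⊆ q → InjectiveOn q → InjectiveOn p
  injectiveOn-⊆ p⊆q f-inj x∈p y∈p = f-inj (p⊆q x∈p) (p⊆q y∈p)

  image-∩ : ∀ {p q q′} → (∀ {x} → x ∈ p → x ∈ q ⇔ f x ∈ q′) → image p ∩ q′ ≡ image (p ∩ q)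
  image-∩ {p} {q} {q′} f-resp = ⊆-antisym image∩⊆ ⊆image∩
    where
    image∩⊆ : image p ∩ q′ ⊆ image (p ∩ q)
    image∩⊆ y∈ with x∈p∩q⁻ (image p) q′ y∈
    ... | y∈img , y∈q′ with ∈-image⁻ y∈img
    ... | x , x∈p , refl = ∈-image⁺ (x∈p∩q⁺ (x∈p , Equivalence.from (f-resp x∈p) y∈q′))
    ⊆image∩ : image (p ∩ q) ⊆ image p ∩ q′
    ⊆image∩ y∈ with ∈-image⁻ y∈
    ... | x , x∈p∩q , refl with x∈p∩q⁻ p q x∈p∩q
    ... | x∈p , x∈q = x∈p∩q⁺ (∈-image⁺ x∈p , Equivalence.to (f-resp x∈p) x∈q)

SeparatedOn : ∀ {n} → (Fin n → Fin n → ℚ) → ℚ → (Fin n → Fin n) → Subset n → Set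
SeparatedOn d t f O = ∀ {x y} → x ∈ O → y ∈ O → x ≢ y → t ℚ.≤ d (f x) (f y)

Near : ∀ {n} → (Fin n → Fin n → ℚ) → ℚ → Subset n → Fin n → Set
Near d γ C x = ∃[ c ] c ∈ C × d x c < γ

module _ {n} {d : Fin n → Fin n → ℚ} (metric : IsMetric d) where
  open IsMetric metric using (zero-self; triangle) renaming (sym to d-sym)

  near-separated : ∀ {γ x y c c′} → d x c < γ → d y c′ < γ → γ ℚ.+ (γ ℚ.+ γ) ℚ.≤ d x y → γ ℚ.≤ d c c′
  near-separated {γ} {x} {y} {c} {c′} dxc<γ dyc′<γ 3γ≤dxy = ℚ.≮⇒≥ λ dcc′<γ → ℚ.<-irrefl refl (begin-strict
    γ ℚ.+ (γ ℚ.+ γ)               ≤⟨ 3γ≤dxy ⟩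
    d x y                         ≤⟨ triangle x c y ⟩
    d x c ℚ.+ d c y               ≤⟨ ℚ.+-monoʳ-≤ (d x c) (triangle c c′ y) ⟩
    d x c ℚ.+ (d c c′ ℚ.+ d c′ y) <⟨ ℚ.+-mono-< dxc<γ (ℚ.+-mono-< dcc′<γ (subst (_< γ) (d-sym y c′) dyc′<γ)) ⟩
    γ ℚ.+ (γ ℚ.+ γ)               ∎)
    where open ℚ.≤-Reasoning

  separated⇒injectiveOn : ∀ {γ O} (f : Fin n → Fin n) → 0ℚ < γ → SeparatedOn d γ f O → InjectiveOn f O
  separated⇒injectiveOn {γ} f 0<γ separated {x} {y} x∈O y∈O fx≡fy = decidable-stable (x ≟ y) λ x≢y →
    ℚ.<-irrefl refl (ℚ.<-≤-trans 0<γ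
      (subst (γ ℚ.≤_) (trans (cong (d (f x)) (sym fx≡fy)) (zero-self (f x))) (separated x∈O y∈O x≢y)))

module _ {n m} (col : Fin n → Fin m) (d : Fin n → Fin n → ℚ) where

  ∈Class⁻ : ∀ {i x} → x ∈ Class col d i → col x ≡ i
  ∈Class⁻ {i} = ∈-tabulate⁻ (λ v → col v ≟ i)

  ∈Class⁺ : ∀ {i x} → col x ≡ i → x ∈ Class col d i
  ∈Class⁺ {i} = ∈-tabulate⁺ (λ v → col v ≟ i)

  Class-resp-col : ∀ {i x y} → col x ≡ col y → x ∈ Class col d i ⇔ y ∈ Class col d i
  Class-resp-col eq = mk⇔ (∈Class⁺ ∘ trans (sym eq) ∘ ∈Class⁻) (∈Class⁺ ∘ trans eq ∘ ∈Class⁻)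

  ∈Ball⁻ : ∀ {i γ v x} → x ∈ Ball col d i γ v → d x v < γ
  ∈Ball⁻ {i} {γ} {v} = proj₂ ∘ ∈-tabulate⁻ (λ w → (col w ≟ i) ×-dec (d w v <? γ))

  Fair-resp-∣∩Class∣ : ∀ {k ℓ u} S T → ∣ T ∣ ≡ ∣ S ∣ → (∀ i → ∣ T ∩ Class col d i ∣ ≡ ∣ S ∩ Class col d i ∣) →
    Fair col d k ℓ u S → Fair col d k ℓ u T
  Fair-resp-∣∩Class∣ {ℓ = ℓ} {u} _ _ ∣T∣≡∣S∣ ∣T∩V∣≡∣S∩V∣ (∣S∣≡k , counts) =
    trans ∣T∣≡∣S∣ ∣S∣≡k ,
    λ i → subst (ℓ i ≤_) (sym (∣T∩V∣≡∣S∩V∣ i)) (proj₁ (counts i)) , subst (_≤ u i) (sym (∣T∩V∣≡∣S∩V∣ i)) (proj₂ (counts i))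

  image-DivAtLeast : ∀ {O t} (f : Fin n → Fin n) → SeparatedOn d t f O → DivAtLeast col d (image f O) t
  image-DivAtLeast f separated y y′ y∈ y′∈ y≢y′ with ∈-image⁻ f y∈ | ∈-image⁻ f y′∈
  ... | x , x∈O , refl | x′ , x′∈O , refl = separated x∈O x′∈O (y≢y′ ∘ cong f)

  module _ {γ : ℚ} {b : ℕ} (i : Fin m) where

    pruneRun-⊆Class : ∀ {M U F} → PruneRun col d i γ b M U F → U ⊆ Class col d i → F ⊆ Class col d i
    pruneRun-⊆Class (stop _) U⊆Vᵢ = U⊆Vᵢ
    pruneRun-⊆Class {U = U} (step v v∈Vᵢ _ _ run) U⊆Vᵢ = pruneRun-⊆Class run
      ([ U⊆Vᵢ , (λ x∈⁅v⁆ → subst (_∈ Class col d i) (sym (x∈⁅y⁆⇒x≡y v x∈⁅v⁆)) v∈Vᵢ) ] ∘ x∈p∪q⁻ U ⁅ v ⁆)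

    pruneRun-covers : ∀ {M U F} → n ≤ b → PruneRun col d i γ b M U F →
      (∀ {x} → x ∈ M → x ∈ Class col d i → Near d γ U x) → ∀ {x} → x ∈ Class col d i → Near d γ F x
    pruneRun-covers _ (stop (inj₁ Vᵢ⊆M)) cover x∈Vᵢ = cover (Vᵢ⊆M _ x∈Vᵢ) x∈Vᵢ
    pruneRun-covers {U = U} n≤b (stop (inj₂ b<∣U∣)) _ _ =
      ⊥-elim (ℕ.<⇒≱ b<∣U∣ (ℕ.≤-trans (∣p∣≤n U) n≤b))
    pruneRun-covers {M} {U} n≤b (step v _ _ _ run) cover = pruneRun-covers n≤b run cover′
      where
      cover′ : ∀ {x} → x ∈ M ∪ Ball col d i γ v → x ∈ Class col d i → Near d γ (U ∪ ⁅ v ⁆) x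
      cover′ {x} x∈ x∈Vᵢ with x∈p∪q⁻ M (Ball col d i γ v) x∈
      ... | inj₁ x∈M with cover x∈M x∈Vᵢ
      ...   | c , c∈U , dxc<γ = c , x∈p∪q⁺ (inj₁ c∈U) , dxc<γ
      cover′ _ _ | inj₂ x∈Ball = v , x∈p∪q⁺ (inj₂ (x∈⁅x⁆ v)) , ∈Ball⁻ x∈Ball

  pruneOutput-near : ∀ {γ b U} → n ≤ b → PruneOutput col d γ b U → ∀ x → Near d γ (U ∩ Class col d (col x)) x
  pruneOutput-near n≤b (Us , runs , refl) x
    with pruneRun-covers (col x) n≤b (runs (col x)) (λ x∈⊥ _ → ⊥-elim (∉⊥ x∈⊥)) (∈Class⁺ refl)
  ... | c , c∈Us , dxc<γ =
    c , x∈p∩q⁺ (x∈⋃⁺ (Any.tabulate⁺ (col x) c∈Us) , pruneRun-⊆Class (col x) (runs (col x)) ⊥⊆ c∈Us) , dxc<γ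

module _ (τ : ℚ) where
  private
    t : ℚ
    t = 1/ (+ 3 / 1)

  τ÷3-thrice : τ ÷ (+ 3 / 1) ℚ.+ (τ ÷ (+ 3 / 1) ℚ.+ τ ÷ (+ 3 / 1)) ≡ τ
  τ÷3-thrice = begin
    τ ℚ.* t ℚ.+ (τ ℚ.* t ℚ.+ τ ℚ.* t) ≡⟨ cong (ℚ._+_ (τ ℚ.* t)) (sym (ℚ.*-distribˡ-+ τ t t)) ⟩
    τ ℚ.* t ℚ.+ τ ℚ.* (t ℚ.+ t)       ≡⟨ sym (ℚ.*-distribˡ-+ τ t (t ℚ.+ t)) ⟩
    τ ℚ.* ℚ.1ℚ                        ≡⟨ ℚ.*-identityʳ τ ⟩
    τ                                 ∎
    where open ≡-Reasoning

  0<τ÷3 : 0ℚ < τ → 0ℚ < τ ÷ (+ 3 / 1)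
  0<τ÷3 0<τ = subst (_< τ ÷ (+ 3 / 1)) (ℚ.*-zeroˡ t) (ℚ.*-monoˡ-<-pos t 0<τ)

module Recentre {n m} (col : Fin n → Fin m) {d : Fin n → Fin n → ℚ} (metric : IsMetric d) {γ : ℚ} {U : Subset n}
  (0<γ : 0ℚ < γ) (near : ∀ x → Near d γ (U ∩ Class col d (col x)) x) where

  centre : Fin n → Fin n
  centre x = proj₁ (near x)

  centre∈U : ∀ x → centre x ∈ U
  centre∈U x = proj₁ (x∈p∩q⁻ U _ (proj₁ (proj₂ (near x))))

  col-centre : ∀ x → col (centre x) ≡ col x
  col-centre x = ∈Class⁻ col d (proj₂ (x∈p∩q⁻ U _ (proj₁ (proj₂ (near x)))))

  image-centre-⊆ : ∀ {O} → image centre O ⊆ U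
  image-centre-⊆ y∈ with ∈-image⁻ centre y∈
  ... | x , _ , refl = centre∈U x

  module _ {O : Subset n} (divO : DivAtLeast col d O (γ ℚ.+ (γ ℚ.+ γ))) where

    centre-separated : SeparatedOn d γ centre O
    centre-separated x∈O y∈O x≢y =
      near-separated metric (proj₂ (proj₂ (near _))) (proj₂ (proj₂ (near _))) (divO _ _ x∈O y∈O x≢y)

    centre-injectiveOn : InjectiveOn centre O
    centre-injectiveOn = separated⇒injectiveOn metric centre 0<γ centre-separated

    image-centre-DivAtLeast : DivAtLeast col d (image centre O) γ
    image-centre-DivAtLeast = image-DivAtLeast col d centre centre-separated

    ∣image-centre∩Class∣ : ∀ i → ∣ image centre O ∩ Class col d i ∣ ≡ ∣ O ∩ Class col d i ∣
    ∣image-centre∩Class∣ i = begin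
      ∣ image centre O ∩ Class col d i ∣   ≡⟨ cong ∣_∣ (image-∩ centre λ {x} _ → Class-resp-col col d (sym (col-centre x))) ⟩
      ∣ image centre (O ∩ Class col d i) ∣ ≡⟨ ∣image∣≡∣p∣ centre (injectiveOn-⊆ centre (p∩q⊆p O _) centre-injectiveOn) ⟩
      ∣ O ∩ Class col d i ∣                ∎
      where open ≡-Reasoning

    image-centre-Fair : ∀ {k ℓ u} → Fair col d k ℓ u O → Fair col d k ℓ u (image centre O)
    image-centre-Fair = Fair-resp-∣∩Class∣ col d O (image centre O)
      (∣image∣≡∣p∣ centre centre-injectiveOn) ∣image-centre∩Class∣

proposition3p2 : (n m : ℕ) (col : Fin n → Fin m) (d : Fin n → Fin n → ℚ) → IsMetric d →
    (k : ℕ) (ℓ u : Fin m → ℕ) → (∀ i → ℓ i ≤ u i) →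
    (τ : ℚ) → 0ℚ < τ →
    (O : Subset n) → Fair col d k ℓ u O → DivAtLeast col d O τ →
    (U : Subset n) → PruneOutput col d (τ ÷ (+ 3 / 1)) n U →
    Σ (Subset n) λ S → (S ⊆ U) × Fair col d k ℓ u S × DivAtLeast col d S (τ ÷ (+ 3 / 1))
proposition3p2 n m col d metric k ℓ u _ τ 0<τ O fairO divO U prune =
  image centre O , image-centre-⊆ , image-centre-Fair div3γ fairO , image-centre-DivAtLeast div3γ
  where
  open Recentre col metric (0<τ÷3 τ 0<τ) (pruneOutput-near col d ℕ.≤-refl prune)

  div3γ : DivAtLeast col d O (τ ÷ (+ 3 / 1) ℚ.+ (τ ÷ (+ 3 / 1) ℚ.+ τ ÷ (+ 3 / 1)))
  div3γ = subst (DivAtLeast col d O) (sym (τ÷3-thrice τ)) divO
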